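{- For every unsatisfiable formula $\Gamma$ and every $m\in\mathbb{N}^+$, $\mathrm{size}_{\mathsf{SBC}^- }(\mathcal{I}_m(\Gamma))\ge\min\{2^m,\ \mathrm{size}_{\mathsf{SBC}^- }(\Gamma)\}$.
   Context: A literal is a variable $v$ or its negation $\bar v$. A clause is a nontautological set of literals; $\bot$ is the empty clause; a formula is a finite set of clauses; $\mathrm{var}(\Gamma)$ is its set of variables. For a set $L$ of literals, $\bar L=\{\bar\ell:\ell\in L\}$. $D$ is a weakening of $C$ if $C\subseteq D$. If $C\cup\{x\}$, $D\cup\{\bar x\}$ are clauses with $x,\bar x\notin C\cup D$ and $C\cup D$ nontautological, $C\cup D$ is their resolvent. For a clause $C$ and formula $\Delta$, $C\vee\Delta=\{C\cup D: D\in\Delta,\ C\cup D \text{ nontautological}\}$. Resolution proof of $\Gamma$: sequence of formulas $(\Gamma_1,\dots,\Gamma_N)$, $\Gamma_1=\Gamma$, $\bot\in\Gamma_N$, each $\Gamma_{i+1}=\Gamma_i\cup\{C\}$ with $C$ a resolvent of two clauses of $\Gamma_i$ or a weakening of a clause of $\Gamma_i$; size $N$. $C$ is a set-blocked clause (SBC) for nonempty $L\subseteq C$ w.r.t. $\Gamma$ if for every $D\in\Gamma$ with $D\cap\bar L\ne\varnothing$, $D\cap L=\varnothing$, the set $(C\setminus L)\cup(D\setminus\bar L)$ is tautological. An $\mathsf{SBC}$ proof is like a resolution proof but additionally allows adding a clause that is an SBC w.r.t. the current $\Gamma_i$; an $\mathsf{SBC}^-$ proof of $\Gamma$ uses only variables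 from $\mathrm{var}(\Gamma)$. $\mathrm{size}_{P}(\Gamma)$ is the minimum size of a $P$-proof of $\Gamma$ ($\infty$ if none). Extended resolution: for a formula $\Delta$, literals $p,q$ and a variable $x$ not occurring in $\Delta,p,q$, $\{\bar x\vee p,\ \bar x\vee q,\ x\vee\bar p\vee\bar q\}$ is a set of extension clauses for $\Delta$. $\Lambda$ is an extension for $\Gamma$ if $\Lambda=\bigcup_{i=1}^t\lambda_i$ with each $\lambda_i$ a set of extension clauses for $\Gamma\cup\lambda_1\cup\dots\cup\lambda_{i-1}$. An $\mathsf{ER}$ proof of $\Gamma$ is a pair $(\Lambda,\Pi)$ with $\Lambda$ an extension for $\Gamma$ and $\Pi$ a resolution proof of $\Gamma\cup\Lambda$; size $|\Lambda|+|\Pi|$. Construction: for unsatisfiable $\Gamma$, fix a minimum-size $\mathsf{ER}$ proof $(\Lambda,\Pi)$ of $\Gamma$, $\Lambda$ being the union of $t(\Gamma)=|\Lambda|/3$ sets $\lambda_i=\{\bar x_i\vee p_i,\ \bar x_i\vee q_i,\ x_i\vee\bar p_i\vee\bar q_i\}$ with extension variables $x_1,\dots,x_{t(\Gamma)}$. For $m\in\mathbb{N}^+$ let $y_1,\dots,y_m,z_1,\dots,z_m$ be $2m$ distinct variables not in $\mathrm{var}(\Gamma\cup\Lambda)$, and define $V_m(\Gamma)=\bigcup_{i=1}^{t(\Gamma)}\bigcup_{j=1}^m\{x_i\vee y_j\vee\bar z_j,\ \bar x_i\vee y_j\vee\bar z_j\}$, $W_m(\Gamma)=\bigcup_{j=1}^m\big[\{\bar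 y_j\vee z_j\}\cup(y_j\vee\Gamma)\cup(\bar z_j\vee\Gamma)\big]$, $\mathcal{I}_m(\Gamma)=\Gamma\cup V_m(\Gamma)\cup W_m(\Gamma)$. -}

module Defs where

open import Data.Nat using (ℕ; suc; _+_; _*_; _≤_)
open import Data.Bool using (Bool; true; false; not)
open import Data.Fin using (Fin)
open import Data.Product using (Σ; _×_; _,_; proj₁; proj₂)
open import Data.Sum using (_⊎_)
open import Data.Unit using (⊤)
open import Data.List using (List; []; _∷_; _++_; [_]; length; map; concatMap; filter; allFin)
open import Data.List.Relation.Unary.Any using (Any; any?)
open import Data.List.Relation.Unary.All using (All)
open import Data.List.Membership.DecPropositional as DecMem using ()
open import Data.Product.Properties using (≡-dec)
import Data.Nat as N
import Data.Bool as B
open import Relation.Nullary using (¬_; Dec)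
open import Relation.Nullary.Decidable using (¬?)
open import Relation.Binary.PropositionalEquality using (_≡_; _≢_)
open import Relation.Binary using (DecidableEquality)

Var : Set
Var = ℕ

-- a literal (v , true) is v, (v , false) is its negation v̄
Lit : Set
Lit = Var × Bool

var : Lit → Var
var = proj₁

neg : Lit → Lit
neg (v , b) = (v , not b)

_≟L_ : DecidableEquality Lit
_≟L_ = ≡-dec N._≟_ B._≟_

open DecMem _≟L_ using (_∈_; _∉_; _∈?_)

-- clauses are finite sets of literals, represented by lists
-- (all notions below only depend on list membership)
Clause : Set
Clause = List Lit

-- formulas are finite sets of clauses, represented by lists
Formula : Set
Formula = List Clause

_∈C_ : Clause → Formula → Set
C ∈C Γ = Any (C ≡_) Γ

Tautological : Clause → Set
Tautological C = Any (λ l → neg l ∈ C) C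

tautological? : (C : Clause) → Dec (Tautological C)
tautological? C = any? (λ l → neg l ∈? C) C

IsClause : Clause → Set
IsClause C = ¬ Tautological C

IsFormula : Formula → Set
IsFormula Γ = All IsClause Γ

OccursIn : Var → Formula → Set
OccursIn v Γ = Any (Any (λ l → var l ≡ v)) Γ

SatLit : (Var → Bool) → Lit → Set
SatLit α (v , b) = α v ≡ b

Satisfiable : Formula → Set
Satisfiable Γ = Σ (Var → Bool) λ α → All (Any (SatLit α)) Γ

Unsatisfiable : Formula → Set
Unsatisfiable Γ = ¬ Satisfiable Γ

-- E = C ∪ D is the resolvent of C1 = C ∪ {x} and C2 = D ∪ {x̄}
Resolvent : Clause → Clause → Clause → Set
Resolvent C₁ C₂ E = Σ Lit λ x →
  x ∈ C₁ × neg x ∈ C₂ × neg x ∉ C₁ × x ∉ C₂ ×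
  (∀ l → (l ∈ E → (l ∈ C₁ × l ≢ x) ⊎ (l ∈ C₂ × l ≢ neg x))
       × ((l ∈ C₁ × l ≢ x) ⊎ (l ∈ C₂ × l ≢ neg x) → l ∈ E)) ×
  IsClause E

Weakening : Clause → Clause → Set
Weakening C E = (∀ l → l ∈ C → l ∈ E) × IsClause E

ResRule : Formula → Clause → Set
ResRule Δ E =
  (Σ Clause λ C₁ → Σ Clause λ C₂ → C₁ ∈C Δ × C₂ ∈C Δ × Resolvent C₁ C₂ E)
  ⊎ (Σ Clause λ C → C ∈C Δ × Weakening C E)

SetBlocked : Clause → List Lit → Formula → Set
SetBlocked C L Γ =
  IsClause C ×
  Any (λ _ → ⊤) L ×
  (∀ l → l ∈ L → l ∈ C) ×
  (∀ D → D ∈C Γ → Any (λ l → neg l ∈ D) L → All (λ l → l ∉ D) L →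
     Σ Lit λ l → InU D l × InU D (neg l))
  where
  -- membership in (C \ L) ∪ (D \ L̄)
  InU : Clause → Lit → Set
  InU D l = (l ∈ C × l ∉ L) ⊎ (l ∈ D × neg l ∉ L)

SBCRule : Formula → Clause → Set
SBCRule Δ E = ResRule Δ E ⊎ Σ (List Lit) (λ L → SetBlocked E L Δ)

-- Proofs: Γ₁ = Γ, Γ_{k+1} = Γ_k ∪ {C_k}; steps = [C_1, ..., C_{N-1}]

ValidSteps : (Formula → Clause → Set) → Formula → List Clause → Set
ValidSteps R Δ [] = ⊤
ValidSteps R Δ (C ∷ Cs) = R Δ C × ValidSteps R (C ∷ Δ) Cs

final : Formula → List Clause → Formula
final Δ [] = Δ
final Δ (C ∷ Cs) = final (C ∷ Δ) Cs

record Proof (R : Formula → Clause → Set) (Γ : Formula) : Set where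
  field
    steps   : List Clause
    valid   : ValidSteps R Γ steps
    refutes : [] ∈C final Γ steps

-- size = number N of formulas in the sequence (Γ₁,…,Γ_N)
size : ∀ {R Γ} → Proof R Γ → ℕ
size P = suc (length (Proof.steps P))

ResProof : Formula → Set
ResProof = Proof ResRule

SBCProof : Formula → Set
SBCProof = Proof SBCRule

record SBC⁻Proof (Γ : Formula) : Set where
  field
    proof    : SBCProof Γ
    onlyVars : All (All (λ l → OccursIn (var l) Γ)) (Proof.steps proof)

sizeSBC⁻ : ∀ {Γ} → SBC⁻Proof Γ → ℕ
sizeSBC⁻ P = size (SBC⁻Proof.proof P)

-- an extension step (x , p , q) introduces x ↔ p ∧ q
ExtStep : Set
ExtStep = Var × Lit × Lit

extVar : ExtStep → Var
extVar (x , _ , _) = x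

extClauses : ExtStep → Formula
extClauses (x , p , q) =
  ((x , false) ∷ p ∷ []) ∷ ((x , false) ∷ q ∷ []) ∷ ((x , true) ∷ neg p ∷ neg q ∷ []) ∷ []

-- each λ_i is a set of extension clauses for Δ ∪ λ_1 ∪ … ∪ λ_{i-1};
-- p ≢ neg q ensures the third one is a clause (nontautological)
ValidExt : Formula → List ExtStep → Set
ValidExt Δ [] = ⊤
ValidExt Δ ((x , p , q) ∷ es) =
  ¬ OccursIn x Δ × var p ≢ x × var q ≢ x × p ≢ neg q ×
  ValidExt (Δ ++ extClauses (x , p , q)) es

record ERProof (Γ : Formula) : Set where
  field
    ext   : List ExtStep
    valid : ValidExt Γ ext
    Π     : ResProof (Γ ++ concatMap extClauses ext)

-- |Λ| + |Π|, with |Λ| = 3 t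
sizeER : ∀ {Γ} → ERProof Γ → ℕ
sizeER e = 3 * length (ERProof.ext e) + size (ERProof.Π e)

MinimumER : (Γ : Formula) → ERProof Γ → Set
MinimumER Γ e = ∀ (e' : ERProof Γ) → sizeER e ≤ sizeER e'

Λ-of : ∀ {Γ} → ERProof Γ → Formula
Λ-of e = concatMap extClauses (ERProof.ext e)

_∨F_ : Lit → Formula → Formula
ℓ ∨F Δ = filter (λ C → ¬? (tautological? C)) (map (ℓ ∷_) Δ)

FreshYZ : (Γ : Formula) → ERProof Γ → (m : ℕ) → (Fin m → Var) → (Fin m → Var) → Set
FreshYZ Γ e m y z =
  (∀ i j → y i ≡ y j → i ≡ j) ×
  (∀ i j → z i ≡ z j → i ≡ j) ×
  (∀ i j → y i ≢ z j) ×
  (∀ j → ¬ OccursIn (y j) (Γ ++ Λ-of e)) ×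
  (∀ j → ¬ OccursIn (z j) (Γ ++ Λ-of e))

V : ∀ {Γ} → ERProof Γ → (m : ℕ) → (Fin m → Var) → (Fin m → Var) → Formula
V e m y z = concatMap (λ s → concatMap (λ j →
    ((extVar s , true)  ∷ (y j , true) ∷ (z j , false) ∷ []) ∷
    ((extVar s , false) ∷ (y j , true) ∷ (z j , false) ∷ []) ∷ [])
  (allFin m)) (ERProof.ext e)

W : Formula → (m : ℕ) → (Fin m → Var) → (Fin m → Var) → Formula
W Γ m y z = concatMap (λ j →
    ((y j , false) ∷ (z j , true) ∷ []) ∷ ((y j , true) ∨F Γ) ++ ((z j , false) ∨F Γ))
  (allFin m)

I : (Γ : Formula) → ERProof Γ → (m : ℕ) → (Fin m → Var) → (Fin m → Var) → Formula
I Γ e m y z = Γ ++ V e m y z ++ W Γ m y z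

-- If an SBC⁻ refutation of Iₘ(Γ) has fewer than 2^m clauses, some b ∈ {0,1}^m differs, at some
-- position j, from the profile j ↦ [ȳ_j ∈ C] of each of its clauses C. Setting y_j = z_j = b_j
-- satisfies Vₘ and every ȳ_j ∨ z_j and turns y_j ∨ Γ or z̄_j ∨ Γ into Γ, so restricting the
-- refutation (dropping satisfied clauses, deleting fixed literals from the others) yields a refutation
-- of Γ that is no longer. Resolution and weakening steps survive restriction, and a set-blocked step
-- survives as long as its blocking set contains no fixed variable. A blocking literal over y_j or z_j
-- would make Γ satisfiable or clash with ȳ_j ∨ z_j; one over an extension variable would, through
-- the clauses x ∨ y_j ∨ z̄_j and x̄ ∨ y_j ∨ z̄_j, force the profile of C at j to agree with b.

module Submission where

open import Defs
open import Data.Nat using (ℕ; zero; suc; _≟_; _+_; _≤_; _<_; _^_; _<?_; _≤?_; z≤n; s≤s)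
open import Data.Nat.Properties
  using (+-suc; +-identityʳ; ≮⇒≥; ≰⇒>; +-monoˡ-≤; ≤-<-trans; +-cancelˡ-<; n<1+n; <-trans; m≤n⇒m≤1+n)
open import Data.Bool using (Bool; true; false; not; if_then_else_)
import Data.Bool as Bool
open import Data.Bool.Properties using (not-involutive; not-¬; ¬-not)
open import Data.Fin using (Fin)
import Data.Fin as Fin
import Data.Fin.Properties as FinP
open import Data.Vec.Functional using (tail) renaming (_∷_ to _∷ᶠ_)
open import Data.Product using (Σ; _×_; _,_; proj₁; proj₂; ∃)
import Data.Product as Product
open import Data.Sum using (_⊎_; inj₁; inj₂)
import Data.Sum as Sum
open import Data.Empty using (⊥; ⊥-elim)
open import Data.Unit using (tt)
open import Data.List using (List; []; _∷_; length; map; filter; allFin)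
open import Data.List.Properties using (filter-all; filter-reject; length-map)
open import Data.List.Relation.Unary.Any using (Any; here; there; any?)
import Data.List.Relation.Unary.Any as Any
open import Data.List.Relation.Unary.Any.Properties using (++⁺ˡ)
open import Data.List.Relation.Unary.All using (All; []; _∷_)
import Data.List.Relation.Unary.All as All
open import Data.List.Relation.Unary.All.Properties using (map⁻)
open import Data.List.Membership.Propositional using (_∈_; _∉_; find; lose)
open import Data.List.Membership.Propositional.Properties
  using (∈-filter⁺; ∈-filter⁻; ∈-map⁺; ∈-map⁻; ∈-++⁺ˡ; ∈-++⁺ʳ; ∈-++⁻; ∈-concatMap⁺; ∈-concatMap⁻; ∈-allFin)
open import Data.List.Membership.DecPropositional _≟L_ using (_∈?_)
open import Data.List.Relation.Binary.Subset.Propositional using (_⊆_)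
open import Data.List.Relation.Binary.Subset.Propositional.Properties using (filter-⊆; Any-resp-⊆)
open import Function using (id; _∘_)
open import Relation.Nullary using (¬_; yes; no; does)
open import Relation.Nullary.Decidable using (¬?; _×-dec_)
open import Relation.Unary using (Decidable)
open import Relation.Binary.PropositionalEquality using (_≡_; _≢_; refl; sym; trans; cong; subst; subst₂; ≢-sym)

neg-involutive : ∀ l → neg (neg l) ≡ l
neg-involutive (v , s) = cong (v ,_) (not-involutive s)

neg-≢ : ∀ l → neg l ≢ l
neg-≢ (v , s) eq = not-¬ refl (sym (cong proj₂ eq))

SatLit-neg : ∀ α {l} → SatLit α l → ¬ SatLit α (neg l)
SatLit-neg α sat sat' = not-¬ sat sat'

¬SatLit⇒SatLit-neg : ∀ α {l} → ¬ SatLit α l → SatLit α (neg l)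
¬SatLit⇒SatLit-neg α = ¬-not

tautological-⊆ : ∀ {C E} → C ⊆ E → Tautological C → Tautological E
tautological-⊆ C⊆E taut with find taut
... | l , l∈C , l̄∈C = lose (C⊆E l∈C) (C⊆E l̄∈C)

∷-isClause : ∀ {w G} → (∀ {k} → k ∈ G → var w ≢ var k) → IsClause G → IsClause (w ∷ G)
∷-isClause {w} fresh clG (here (here w̄≡w)) = neg-≢ w w̄≡w
∷-isClause {w} fresh clG (here (there w̄∈G)) = fresh w̄∈G refl
∷-isClause fresh clG (there taut) with find taut
... | k , k∈G , here k̄≡w = fresh k∈G (sym (cong var k̄≡w))
... | k , k∈G , there k̄∈G = clG (lose k∈G k̄∈G)

module SetBlockedClause {C L Δ} (blocked : SetBlocked C L Δ) where

  private
    clC : IsClause C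
    clC = proj₁ blocked

  L⊆C : ∀ {l} → l ∈ L → l ∈ C
  L⊆C = proj₁ (proj₂ (proj₂ blocked)) _

  L-consistent : ∀ {l} → l ∈ L → neg l ∈ L → ⊥
  L-consistent l∈L l̄∈L = clC (lose (L⊆C l∈L) (L⊆C l̄∈L))

  complement-in-clause : ∀ {D} → D ∈ Δ → IsClause D → Any (λ l → neg l ∈ D) L → All (_∉ D) L →
                         ∃ λ u → u ∈ D × neg u ∈ C × neg u ∉ L
  complement-in-clause {D} D∈Δ clD hit miss
    with proj₂ (proj₂ (proj₂ blocked)) D D∈Δ hit miss
  ... | u , inj₁ (u∈C , _) , inj₁ (ū∈C , _) = ⊥-elim (clC (lose u∈C ū∈C))
  ... | u , inj₂ (u∈D , _) , inj₂ (ū∈D , _) = ⊥-elim (clD (lose u∈D ū∈D))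
  ... | u , inj₂ (u∈D , ū∉L) , inj₁ (ū∈C , _) = u , u∈D , ū∈C , ū∉L
  ... | u , inj₁ (u∈C , u∉L) , inj₂ (ū∈D , _) =
    neg u , ū∈D , subst (_∈ C) (sym (neg-involutive u)) u∈C , subst (_∉ L) (sym (neg-involutive u)) u∉L

  -- an assignment satisfying every literal of L and falsifying every literal of C \ L
  γ : Var → Bool
  γ v with (v , true) ∈? L | (v , false) ∈? L | (v , true) ∈? C
  ... | yes _ | _     | _     = true
  ... | no _  | yes _ | _     = false
  ... | no _  | no _  | yes _ = false
  ... | no _  | no _  | no _  = true

  γ-satisfies-L : ∀ {l} → l ∈ L → SatLit γ l
  γ-satisfies-L {v , s} l∈L with (v , true) ∈? L | (v , false) ∈? L | (v , true) ∈? C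
  γ-satisfies-L {v , true}  l∈L | yes _   | _     | _ = refl
  γ-satisfies-L {v , false} l∈L | yes t∈L | _     | _ = ⊥-elim (L-consistent t∈L l∈L)
  γ-satisfies-L {v , true}  l∈L | no t∉L  | _     | _ = ⊥-elim (t∉L l∈L)
  γ-satisfies-L {v , false} l∈L | no _    | yes _ | _ = refl
  γ-satisfies-L {v , false} l∈L | no _    | no f∉L | _ = ⊥-elim (f∉L l∈L)

  γ-falsifies-C∖L : ∀ {u} → neg u ∈ C → neg u ∉ L → SatLit γ u
  γ-falsifies-C∖L {v , s} ū∈C ū∉L with (v , true) ∈? L | (v , false) ∈? L | (v , true) ∈? C
  γ-falsifies-C∖L {v , true}  ū∈C ū∉L | yes _ | _ | _ = refl
  γ-falsifies-C∖L {v , false} ū∈C ū∉L | yes t∈L | _ | _ = ⊥-elim (ū∉L t∈L)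
  γ-falsifies-C∖L {v , true}  ū∈C ū∉L | no _ | yes f∈L | _ = ⊥-elim (ū∉L f∈L)
  γ-falsifies-C∖L {v , false} ū∈C ū∉L | no _ | yes _ | _ = refl
  γ-falsifies-C∖L {v , true}  ū∈C ū∉L | no _ | no _ | yes t∈C = ⊥-elim (clC (lose t∈C ū∈C))
  γ-falsifies-C∖L {v , false} ū∈C ū∉L | no _ | no _ | yes _ = refl
  γ-falsifies-C∖L {v , true}  ū∈C ū∉L | no _ | no _ | no _ = refl
  γ-falsifies-C∖L {v , false} ū∈C ū∉L | no _ | no _ | no t∉C = ⊥-elim (t∉C ū∈C)

  -- Each a ∨ G meets L̄, so it meets L or its blocked resolvent with C is tautological; either way γ satisfies G.
  satisfiable-if-covered : ∀ {a} → neg a ∈ L → (Ψ : Formula) →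
                           (∀ {G} → G ∈ Ψ → (a ∷ G) ∈ Δ × IsClause (a ∷ G)) → Satisfiable Ψ
  satisfiable-if-covered {a} ā∈L Ψ covered = γ , All.tabulate satisfied
    where
    satisfied : ∀ {G} → G ∈ Ψ → Any (SatLit γ) G
    satisfied {G} G∈Ψ with any? (_∈? (a ∷ G)) L
    ... | yes hit with find hit
    ...   | k , k∈L , here refl = ⊥-elim (L-consistent k∈L ā∈L)
    ...   | k , k∈L , there k∈G = lose k∈G (γ-satisfies-L k∈L)
    satisfied {G} G∈Ψ | no miss
      with complement-in-clause (proj₁ (covered G∈Ψ)) (proj₂ (covered G∈Ψ))
             (lose ā∈L (here (neg-involutive a))) (All.tabulate λ k∈L k∈aG → miss (lose k∈L k∈aG))
    ... | _ , here refl , ā∈C , ā∉L = ⊥-elim (ā∉L ā∈L)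
    ... | u , there u∈G , ū∈C , ū∉L = lose u∈G (γ-falsifies-C∖L ū∈C ū∉L)

resolvent-⊆ˡ : ∀ {C₁ C₂ E} (r : Resolvent C₁ C₂ E) → ∀ {l} → l ∈ C₁ → l ≢ proj₁ r → l ∈ E
resolvent-⊆ˡ (_ , _ , _ , _ , _ , char , _) l∈C₁ l≢x = proj₂ (char _) (inj₁ (l∈C₁ , l≢x))

resolvent-⊆ʳ : ∀ {C₁ C₂ E} (r : Resolvent C₁ C₂ E) → ∀ {l} → l ∈ C₂ → l ≢ neg (proj₁ r) → l ∈ E
resolvent-⊆ʳ (_ , _ , _ , _ , _ , char , _) l∈C₂ l≢x̄ = proj₂ (char _) (inj₂ (l∈C₂ , l≢x̄))

resolvent-isClause : ∀ {C₁ C₂ E} → Resolvent C₁ C₂ E → IsClause E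
resolvent-isClause (_ , _ , _ , _ , _ , _ , clE) = clE

InBlockedResolvent : Clause → List Lit → Clause → Lit → Set
InBlockedResolvent C L D u = (u ∈ C × u ∉ L) ⊎ (u ∈ D × neg u ∉ L)

-- Restriction of clauses by the partial assignment that sets every variable outside Γ according to α.
module Restriction (Γ : Formula) (α : Var → Bool) where

  Free : Lit → Set
  Free l = OccursIn (var l) Γ

  free? : Decidable Free
  free? l = any? (any? (λ k → var k ≟ var l)) Γ

  Forced : Lit → Set
  Forced l = ¬ Free l × SatLit α l

  Satisfied : Clause → Set
  Satisfied = Any Forced

  Falsified : Clause → Set
  Falsified C = ¬ Satisfied C

  satLit? : Decidable (SatLit α)
  satLit? l = α (var l) Bool.≟ proj₂ l

  satisfied? : Decidable Satisfied
  satisfied? = any? λ l → ¬? (free? l) ×-dec satLit? l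

  restrict : Clause → Clause
  restrict = filter free?

  ∈-restrict⁺ : ∀ {l C} → l ∈ C → Free l → l ∈ restrict C
  ∈-restrict⁺ = ∈-filter⁺ free?

  ∈-restrict⁻ : ∀ {l C} → l ∈ restrict C → l ∈ C × Free l
  ∈-restrict⁻ = ∈-filter⁻ free?

  restrict-free : ∀ C → All Free (restrict C)
  restrict-free C = All.tabulate λ l∈ → proj₂ (∈-restrict⁻ {C = C} l∈)

  restrict-isClause : ∀ {C} → IsClause C → IsClause (restrict C)
  restrict-isClause {C} clC = clC ∘ tautological-⊆ (filter-⊆ free? C)

  falsified-fixed : ∀ {C l} → Falsified C → l ∈ C → ¬ Free l → ¬ SatLit α l
  falsified-fixed fC l∈C l-fixed sat = fC (lose l∈C (l-fixed , sat))

  ∈Γ-free : ∀ {G} → G ∈ Γ → All Free G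
  ∈Γ-free G∈Γ = All.tabulate λ k∈G → lose G∈Γ (lose k∈G refl)

  ∈Γ-falsified : ∀ {G} → G ∈ Γ → Falsified G
  ∈Γ-falsified G∈Γ sat with find sat
  ... | _ , k∈G , k-fixed , _ = k-fixed (All.lookup (∈Γ-free G∈Γ) k∈G)

  restrict-∈Γ : ∀ {G} → G ∈ Γ → restrict G ≡ G
  restrict-∈Γ G∈Γ = filter-all free? (∈Γ-free G∈Γ)

  restrict-fixed-∷ : ∀ {w C} → ¬ Free w → restrict (w ∷ C) ≡ restrict C
  restrict-fixed-∷ = filter-reject free?

  falsified-premise : ∀ {C E k} → (∀ {l} → l ∈ C → l ≢ k → l ∈ E) → ¬ Forced k → Falsified E → Falsified C
  falsified-premise {k = k} C⊆E+k k-unforced fE sat with find sat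
  ... | l , l∈C , forced with l ≟L k
  ...   | yes refl = k-unforced forced
  ...   | no l≢k = fE (lose (C⊆E+k l∈C l≢k) forced)

  restrict-premise : ∀ {C E k} → (∀ {l} → l ∈ C → l ≢ k → l ∈ E) → ¬ Free k → restrict C ⊆ restrict E
  restrict-premise C⊆E+k k-fixed l∈ with ∈-restrict⁻ l∈
  ... | l∈C , l-free = ∈-restrict⁺ (C⊆E+k l∈C λ { refl → k-fixed l-free }) l-free

  restrict-weakening : ∀ {C E} → Weakening C E → Weakening (restrict C) (restrict E)
  restrict-weakening (C⊆E , clE) =
    (λ _ l∈ → let (l∈C , l-free) = ∈-restrict⁻ l∈ in ∈-restrict⁺ (C⊆E _ l∈C) l-free) , restrict-isClause clE

  restrict-resolvent : ∀ {C₁ C₂ E} (r : Resolvent C₁ C₂ E) → Free (proj₁ r) →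
                       Resolvent (restrict C₁) (restrict C₂) (restrict E)
  restrict-resolvent {C₁} {C₂} {E} (x , x∈C₁ , x̄∈C₂ , x̄∉C₁ , x∉C₂ , char , clE) x-free =
    x , ∈-restrict⁺ x∈C₁ x-free , ∈-restrict⁺ x̄∈C₂ x-free ,
    x̄∉C₁ ∘ proj₁ ∘ ∈-restrict⁻ , x∉C₂ ∘ proj₁ ∘ ∈-restrict⁻ , (λ l → to l , from l) , restrict-isClause clE
    where
    Side : Clause → Clause → Lit → Set
    Side D₁ D₂ l = (l ∈ D₁ × l ≢ x) ⊎ (l ∈ D₂ × l ≢ neg x)

    to : ∀ l → l ∈ restrict E → Side (restrict C₁) (restrict C₂) l
    to l l∈ with ∈-restrict⁻ l∈
    ... | l∈E , l-free = Sum.map (Product.map₁ (λ l∈C → ∈-restrict⁺ l∈C l-free))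
                                 (Product.map₁ (λ l∈C → ∈-restrict⁺ l∈C l-free)) (proj₁ (char l) l∈E)

    from : ∀ l → Side (restrict C₁) (restrict C₂) l → l ∈ restrict E
    from l (inj₁ (l∈ , l≢x)) with ∈-restrict⁻ l∈
    ... | l∈C₁ , l-free = ∈-restrict⁺ (proj₂ (char l) (inj₁ (l∈C₁ , l≢x))) l-free
    from l (inj₂ (l∈ , l≢x̄)) with ∈-restrict⁻ l∈
    ... | l∈C₂ , l-free = ∈-restrict⁺ (proj₂ (char l) (inj₂ (l∈C₂ , l≢x̄))) l-free

  record _⇝_ (Δ Δ' : Formula) : Set where
    field
      image    : ∀ {D} → D ∈ Δ → Falsified D → restrict D ∈ Δ'
      preimage : ∀ {D'} → D' ∈ Δ' → ∃ λ D → D ∈ Δ × Falsified D × restrict D ≡ D'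
  open _⇝_

  ⇝-satisfied-∷ : ∀ {Δ Δ' C} → Δ ⇝ Δ' → Satisfied C → (C ∷ Δ) ⇝ Δ'
  image (⇝-satisfied-∷ ρ sat) (here refl) fC = ⊥-elim (fC sat)
  image (⇝-satisfied-∷ ρ sat) (there D∈Δ) fD = image ρ D∈Δ fD
  preimage (⇝-satisfied-∷ ρ sat) D'∈Δ' with preimage ρ D'∈Δ'
  ... | D , D∈Δ , fD , eq = D , there D∈Δ , fD , eq

  ⇝-falsified-∷ : ∀ {Δ Δ' C} → Δ ⇝ Δ' → Falsified C → (C ∷ Δ) ⇝ (restrict C ∷ Δ')
  image (⇝-falsified-∷ ρ fC) (here refl) _ = here refl
  image (⇝-falsified-∷ ρ fC) (there D∈Δ) fD = there (image ρ D∈Δ fD)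
  preimage (⇝-falsified-∷ {C = C} ρ fC) (here refl) = C , here refl , fC , refl
  preimage (⇝-falsified-∷ ρ fC) (there D'∈Δ') with preimage ρ D'∈Δ'
  ... | D , D∈Δ , fD , eq = D , there D∈Δ , fD , eq

  ⇝-Γ : ∀ {Φ} → Γ ⊆ Φ → (∀ {D} → D ∈ Φ → Falsified D → restrict D ∈ Γ) → Φ ⇝ Γ
  image (⇝-Γ Γ⊆Φ restricts) = restricts
  preimage (⇝-Γ Γ⊆Φ restricts) {G} G∈Γ = G , Γ⊆Φ G∈Γ , ∈Γ-falsified G∈Γ , restrict-∈Γ G∈Γ

  -- A fixed pivot is false in one premise, which is then falsified and restricts to a weakening.
  restrict-resRule : ∀ {Δ Δ' E} → Δ ⇝ Δ' → ResRule Δ E → Falsified E → ResRule Δ' (restrict E)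
  restrict-resRule ρ (inj₂ (C , C∈Δ , w@(C⊆E , _))) fE =
    inj₂ (restrict C , image ρ C∈Δ (fE ∘ Any-resp-⊆ (C⊆E _)) , restrict-weakening w)
  restrict-resRule ρ (inj₁ (C₁ , C₂ , C₁∈Δ , C₂∈Δ , r)) fE with free? (proj₁ r)
  ... | yes x-free =
    inj₁ (restrict C₁ , restrict C₂ ,
          image ρ C₁∈Δ (falsified-premise (resolvent-⊆ˡ r) (λ forced → proj₁ forced x-free) fE) ,
          image ρ C₂∈Δ (falsified-premise (resolvent-⊆ʳ r) (λ forced → proj₁ forced x-free) fE) ,
          restrict-resolvent r x-free)
  ... | no x-fixed with satLit? (proj₁ r)
  ...   | yes x-true =
    inj₂ (restrict C₂ ,
          image ρ C₂∈Δ (falsified-premise (resolvent-⊆ʳ r) (SatLit-neg α x-true ∘ proj₂) fE) ,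
          (λ _ → restrict-premise (resolvent-⊆ʳ r) x-fixed) , restrict-isClause (resolvent-isClause r))
  ...   | no x-false =
    inj₂ (restrict C₁ ,
          image ρ C₁∈Δ (falsified-premise (resolvent-⊆ˡ r) (x-false ∘ proj₂) fE) ,
          (λ _ → restrict-premise (resolvent-⊆ˡ r) x-fixed) , restrict-isClause (resolvent-isClause r))

  unforced-in-blocked-resolvent : ∀ {C L D u} → Falsified C → Falsified D →
                                  InBlockedResolvent C L D u → ¬ Forced u
  unforced-in-blocked-resolvent fC fD (inj₁ (u∈C , _)) = fC ∘ lose u∈C
  unforced-in-blocked-resolvent fC fD (inj₂ (u∈D , _)) = fD ∘ lose u∈D

  complementary-unforced⇒free : ∀ {u} → ¬ Forced u → ¬ Forced (neg u) → Free u
  complementary-unforced⇒free {u} u-unforced ū-unforced with free? u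
  ... | yes u-free = u-free
  ... | no u-fixed with satLit? u
  ...   | yes u-true = ⊥-elim (u-unforced (u-fixed , u-true))
  ...   | no u-false = ⊥-elim (ū-unforced (u-fixed , ¬SatLit⇒SatLit-neg α u-false))

  restrict-blocked-resolvent : ∀ {C L D u} → InBlockedResolvent C L D u → Free u →
                               InBlockedResolvent (restrict C) L (restrict D) u
  restrict-blocked-resolvent in-u u-free =
    Sum.map (Product.map₁ (λ u∈ → ∈-restrict⁺ u∈ u-free)) (Product.map₁ (λ u∈ → ∈-restrict⁺ u∈ u-free)) in-u

  -- The complementary pair witnessing blocking lies in falsified clauses, so its variable is free.
  restrict-setBlocked : ∀ {Δ Δ' C L} → Δ ⇝ Δ' → SetBlocked C L Δ → Falsified C → All Free L →
                        SetBlocked (restrict C) L Δ'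
  restrict-setBlocked {Δ' = Δ'} {C} {L} ρ (clC , nonempty , L⊆C , blocking) fC L-free =
    restrict-isClause clC , nonempty , (λ l l∈L → ∈-restrict⁺ (L⊆C l l∈L) (All.lookup L-free l∈L)) ,
    blocking'
    where
    blocking' : ∀ D' → D' ∈ Δ' → Any (λ l → neg l ∈ D') L → All (_∉ D') L →
                ∃ λ u → InBlockedResolvent (restrict C) L D' u × InBlockedResolvent (restrict C) L D' (neg u)
    blocking' D' D'∈Δ' hit miss with preimage ρ D'∈Δ'
    ... | D , D∈Δ , fD , refl
      with blocking D D∈Δ (Any.map (proj₁ ∘ ∈-restrict⁻) hit)
                      (All.zipWith (λ (l∉D' , l-free) l∈D → l∉D' (∈-restrict⁺ l∈D l-free)) (miss , L-free))
    ... | u , in-u , in-ū =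
      u , restrict-blocked-resolvent in-u u-free , restrict-blocked-resolvent in-ū u-free
      where
      u-free : Free u
      u-free = complementary-unforced⇒free (unforced-in-blocked-resolvent fC fD in-u)
                                            (unforced-in-blocked-resolvent fC fD in-ū)

  restrict-sbcRule : ∀ {Δ Δ' C} → Δ ⇝ Δ' → SBCRule Δ C → Falsified C →
                     (∀ {L} → SetBlocked C L Δ → All Free L) → SBCRule Δ' (restrict C)
  restrict-sbcRule ρ (inj₁ res) fC _ = inj₁ (restrict-resRule ρ res fC)
  restrict-sbcRule ρ (inj₂ (L , blocked)) fC L-free =
    inj₂ (L , restrict-setBlocked ρ blocked fC (L-free blocked))

  restrict-steps : List Clause → List Clause
  restrict-steps [] = []
  restrict-steps (C ∷ Cs) with satisfied? C
  ... | yes _ = restrict-steps Cs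
  ... | no _ = restrict C ∷ restrict-steps Cs

  length-restrict-steps : ∀ Cs → length (restrict-steps Cs) ≤ length Cs
  length-restrict-steps [] = z≤n
  length-restrict-steps (C ∷ Cs) with satisfied? C
  ... | yes _ = m≤n⇒m≤1+n (length-restrict-steps Cs)
  ... | no _ = s≤s (length-restrict-steps Cs)

  restrict-steps-free : ∀ Cs → All (All Free) (restrict-steps Cs)
  restrict-steps-free [] = []
  restrict-steps-free (C ∷ Cs) with satisfied? C
  ... | yes _ = restrict-steps-free Cs
  ... | no _ = restrict-free C ∷ restrict-steps-free Cs

  BlockingFree : Formula → Clause → Set
  BlockingFree Φ C = ∀ {Δ L} → Φ ⊆ Δ → SetBlocked C L Δ → Falsified C → All Free L

  restrict-validSteps : ∀ {Φ Δ Δ'} Cs → Φ ⊆ Δ → Δ ⇝ Δ' → ValidSteps SBCRule Δ Cs → All (BlockingFree Φ) Cs →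
                        ValidSteps SBCRule Δ' (restrict-steps Cs) × final Δ Cs ⇝ final Δ' (restrict-steps Cs)
  restrict-validSteps [] _ ρ _ _ = tt , ρ
  restrict-validSteps (C ∷ Cs) Φ⊆Δ ρ (rule , valid) (blocking-free ∷ blocking-frees) with satisfied? C
  ... | yes sat = restrict-validSteps Cs (there ∘ Φ⊆Δ) (⇝-satisfied-∷ ρ sat) valid blocking-frees
  ... | no fC =
    Product.map₁ (restrict-sbcRule ρ rule fC (λ blocked → blocking-free Φ⊆Δ blocked fC) ,_)
                 (restrict-validSteps Cs (there ∘ Φ⊆Δ) (⇝-falsified-∷ ρ fC) valid blocking-frees)

  restrict-refutation : ∀ {Φ} → Φ ⇝ Γ → (P : SBCProof Φ) → All (BlockingFree Φ) (Proof.steps P) →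
                        Σ (SBC⁻Proof Γ) λ Q → sizeSBC⁻ Q ≤ size P
  restrict-refutation ρ P blocking-frees = Q , s≤s (length-restrict-steps steps)
    where
    open Proof P
    restricted = restrict-validSteps steps id ρ valid blocking-frees
    Q : SBC⁻Proof Γ
    Q = record { proof = record { steps = restrict-steps steps
                                ; valid = proj₁ restricted
                                ; refutes = image (proj₂ restricted) refutes λ () }
               ; onlyVars = restrict-steps-free steps }

  module _ {C L Δ} (blocked : SetBlocked C L Δ) (fC : Falsified C) where
    open SetBlockedClause blocked

    -- Blocking against ā ∨ c̄ would put c into C, but C falsifies both a and c.
    paired-∉ : ∀ {D a c} → ¬ Free a → ¬ Free c → SatLit α a ⊎ SatLit α c →
               D ∈ Δ → IsClause D → neg a ∈ D → (∀ {u} → u ∈ D → u ≡ neg a ⊎ u ≡ neg c) → neg c ∉ L → a ∉ L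
    paired-∉ {D} {a} a-fixed c-fixed a∨c D∈Δ clD ā∈D D⊆āc̄ c̄∉L a∈L
      with complement-in-clause D∈Δ clD (lose a∈L ā∈D) (All.tabulate miss)
      where
      miss : ∀ {k} → k ∈ L → k ∉ D
      miss k∈L k∈D with D⊆āc̄ k∈D
      ... | inj₁ refl = L-consistent a∈L k∈L
      ... | inj₂ refl = c̄∉L k∈L
    ... | u , u∈D , ū∈C , ū∉L with D⊆āc̄ u∈D
    ...   | inj₁ refl = ū∉L (subst (_∈ L) (sym (neg-involutive a)) a∈L)
    ...   | inj₂ refl with a∨c
    ...     | inj₁ a-true = falsified-fixed fC (L⊆C a∈L) a-fixed a-true
    ...     | inj₂ c-true = falsified-fixed fC (subst (_∈ C) (neg-involutive _) ū∈C) c-fixed c-true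

Differs : ∀ {m} → (Fin m → Bool) → (Fin m → Bool) → Set
Differs b p = ∃ λ j → b j ≢ p j

slice : ∀ {m} → Bool → List (Fin (suc m) → Bool) → List (Fin m → Bool)
slice c [] = []
slice c (p ∷ ps) = (if does (p Fin.zero Bool.≟ c) then tail p ∷_ else id) (slice c ps)

length-slices : ∀ {m} (ps : List (Fin (suc m) → Bool)) →
                length (slice true ps) + length (slice false ps) ≡ length ps
length-slices [] = refl
length-slices (p ∷ ps) with p Fin.zero
... | true = cong suc (length-slices ps)
... | false = trans (+-suc _ _) (cong suc (length-slices ps))

differs-slice : ∀ {m} c {f : Fin m → Bool} (ps : List (Fin (suc m) → Bool)) →
                All (Differs f) (slice c ps) → All (Differs (c ∷ᶠ f)) ps
differs-slice c [] _ = []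
differs-slice c (p ∷ ps) ds with p Fin.zero Bool.≟ c
differs-slice c (p ∷ ps) ((j , d) ∷ ds) | yes _ = (Fin.suc j , d) ∷ differs-slice c ps ds
differs-slice c (p ∷ ps) ds             | no p₀≢c = (Fin.zero , ≢-sym p₀≢c) ∷ differs-slice c ps ds

+<+⇒<⊎< : ∀ {a c n} → a + c < n + n → a < n ⊎ c < n
+<+⇒<⊎< {a} {c} {n} lt with a <? n
... | yes a<n = inj₁ a<n
... | no a≮n = inj₂ (+-cancelˡ-< n c n (≤-<-trans (+-monoˡ-≤ c (≮⇒≥ a≮n)) lt))

2^[1+m]≡2^m+2^m : ∀ m → 2 ^ suc m ≡ 2 ^ m + 2 ^ m
2^[1+m]≡2^m+2^m m = cong (2 ^ m +_) (+-identityʳ (2 ^ m))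

∃-small-slice : ∀ {m} (ps : List (Fin (suc m) → Bool)) → length ps < 2 ^ suc m →
                ∃ λ c → length (slice c ps) < 2 ^ m
∃-small-slice {m} ps small
  with +<+⇒<⊎< (subst₂ _<_ (sym (length-slices ps)) (2^[1+m]≡2^m+2^m m) small)
... | inj₁ few = true , few
... | inj₂ few = false , few

∃-differing-from-all : ∀ m (ps : List (Fin m → Bool)) → length ps < 2 ^ m →
                       ∃ λ b → All (Differs b) ps
∃-differing-from-all zero [] _ = (λ ()) , []
∃-differing-from-all zero (_ ∷ _) (s≤s ())
∃-differing-from-all (suc m) ps small =
  let (c , few) = ∃-small-slice ps small
      (f , ds) = ∃-differing-from-all m (slice c ps) few
  in c ∷ᶠ f , differs-slice c ps ds

∨F-∈⁺ : ∀ {w G Δ} → G ∈ Δ → IsClause (w ∷ G) → (w ∷ G) ∈ (w ∨F Δ)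
∨F-∈⁺ {w} G∈Δ clause = ∈-filter⁺ (¬? ∘ tautological?) (∈-map⁺ (w ∷_) G∈Δ) clause

∨F-∈⁻ : ∀ {w D Δ} → D ∈ (w ∨F Δ) → ∃ λ G → G ∈ Δ × D ≡ w ∷ G
∨F-∈⁻ {w} D∈ = ∈-map⁻ (w ∷_) (proj₁ (∈-filter⁻ (¬? ∘ tautological?) D∈))

module Construction (Γ : Formula) (Γ-formula : IsFormula Γ) (Γ-unsat : Unsatisfiable Γ)
                    (e : ERProof Γ) (m : ℕ) (y z : Fin m → Var) (fresh : FreshYZ Γ e m y z) where

  open ERProof e using (ext)

  Iₘ : Formula
  Iₘ = I Γ e m y z

  private
    y-injective : ∀ {i j} → y i ≡ y j → i ≡ j
    y-injective = proj₁ fresh _ _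

    z-injective : ∀ {i j} → z i ≡ z j → i ≡ j
    z-injective = proj₁ (proj₂ fresh) _ _

    y≢z : ∀ {i j} → y i ≢ z j
    y≢z = proj₁ (proj₂ (proj₂ fresh)) _ _

    y∉Γ : ∀ j → ¬ OccursIn (y j) Γ
    y∉Γ j = proj₁ (proj₂ (proj₂ (proj₂ fresh))) j ∘ ++⁺ˡ

    z∉Γ : ∀ j → ¬ OccursIn (z j) Γ
    z∉Γ j = proj₂ (proj₂ (proj₂ (proj₂ fresh))) j ∘ ++⁺ˡ

  fresh-∷-isClause : ∀ {w G} → ¬ OccursIn (var w) Γ → G ∈ Γ → IsClause (w ∷ G)
  fresh-∷-isClause w∉Γ G∈Γ =
    ∷-isClause (λ k∈G eq → w∉Γ (lose G∈Γ (lose k∈G (sym eq)))) (All.lookup Γ-formula G∈Γ)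

  data IClause : Clause → Set where
    Γ-clause : ∀ {G} → G ∈ Γ → IClause G
    V-clause : ∀ {s} → s ∈ ext → ∀ j p → IClause ((extVar s , p) ∷ (y j , true) ∷ (z j , false) ∷ [])
    W-link   : ∀ j → IClause ((y j , false) ∷ (z j , true) ∷ [])
    W-y      : ∀ j {G} → G ∈ Γ → IClause ((y j , true) ∷ G)
    W-z      : ∀ j {G} → G ∈ Γ → IClause ((z j , false) ∷ G)

  IClause⇒∈Iₘ : ∀ {D} → IClause D → D ∈ Iₘ
  IClause⇒∈Iₘ (Γ-clause G∈Γ) = ∈-++⁺ˡ G∈Γ
  IClause⇒∈Iₘ (V-clause {s} s∈ j p) =
    ∈-++⁺ʳ Γ (∈-++⁺ˡ (∈-concatMap⁺ _ (lose s∈ (∈-concatMap⁺ _ (lose (∈-allFin j) (V-pair p))))))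
    where
    V-pair : ∀ p → ((extVar s , p) ∷ (y j , true) ∷ (z j , false) ∷ []) ∈
                   (((extVar s , true) ∷ (y j , true) ∷ (z j , false) ∷ []) ∷
                    ((extVar s , false) ∷ (y j , true) ∷ (z j , false) ∷ []) ∷ [])
    V-pair true = here refl
    V-pair false = there (here refl)
  IClause⇒∈Iₘ (W-link j) = ∈-++⁺ʳ Γ (∈-++⁺ʳ (V e m y z) (∈-concatMap⁺ _ (lose (∈-allFin j) (here refl))))
  IClause⇒∈Iₘ (W-y j G∈Γ) =
    ∈-++⁺ʳ Γ (∈-++⁺ʳ (V e m y z) (∈-concatMap⁺ _ (lose (∈-allFin j)
      (there (∈-++⁺ˡ (∨F-∈⁺ G∈Γ (fresh-∷-isClause (y∉Γ j) G∈Γ)))))))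
  IClause⇒∈Iₘ (W-z j G∈Γ) =
    ∈-++⁺ʳ Γ (∈-++⁺ʳ (V e m y z) (∈-concatMap⁺ _ (lose (∈-allFin j)
      (there (∈-++⁺ʳ ((y j , true) ∨F Γ) (∨F-∈⁺ G∈Γ (fresh-∷-isClause (z∉Γ j) G∈Γ)))))))

  ∈Iₘ⇒IClause : ∀ {D} → D ∈ Iₘ → IClause D
  ∈Iₘ⇒IClause D∈ with ∈-++⁻ Γ D∈
  ... | inj₁ D∈Γ = Γ-clause D∈Γ
  ... | inj₂ D∈VW with ∈-++⁻ (V e m y z) D∈VW
  ... | inj₁ D∈V with find (∈-concatMap⁻ _ {xs = ext} D∈V)
  ...   | s , s∈ , D∈Vs with find (∈-concatMap⁻ _ {xs = allFin m} D∈Vs)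
  ...     | j , _ , here refl = V-clause s∈ j true
  ...     | j , _ , there (here refl) = V-clause s∈ j false
  ∈Iₘ⇒IClause D∈ | inj₂ _ | inj₂ D∈W with find (∈-concatMap⁻ _ {xs = allFin m} D∈W)
  ... | j , _ , here refl = W-link j
  ... | j , _ , there D∈Wj with ∈-++⁻ ((y j , true) ∨F Γ) D∈Wj
  ...   | inj₁ D∈y∨Γ with ∨F-∈⁻ {(y j , true)} {Δ = Γ} D∈y∨Γ
  ...     | G , G∈Γ , refl = W-y j G∈Γ
  ∈Iₘ⇒IClause D∈ | inj₂ _ | inj₂ _ | j , _ , there _ | inj₂ D∈z̄∨Γ with ∨F-∈⁻ {(z j , false)} {Δ = Γ} D∈z̄∨Γ
  ...     | G , G∈Γ , refl = W-z j G∈Γ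

  occurs-Iₘ : ∀ {v} → OccursIn v Iₘ → (∀ j → y j ≢ v) → (∀ j → z j ≢ v) →
              OccursIn v Γ ⊎ ∃ λ s → s ∈ ext × extVar s ≡ v
  occurs-Iₘ occ y≢v z≢v with find occ
  ... | D , D∈Iₘ , v∈D with find v∈D
  ... | k , k∈D , refl with ∈Iₘ⇒IClause D∈Iₘ | k∈D
  ... | Γ-clause G∈Γ      | k∈G                     = inj₁ (lose G∈Γ (lose k∈G refl))
  ... | V-clause s∈ j p   | here refl               = inj₂ (_ , s∈ , refl)
  ... | V-clause s∈ j p   | there (here refl)       = ⊥-elim (y≢v j refl)
  ... | V-clause s∈ j p   | there (there (here refl)) = ⊥-elim (z≢v j refl)
  ... | W-link j          | here refl               = ⊥-elim (y≢v j refl)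
  ... | W-link j          | there (here refl)       = ⊥-elim (z≢v j refl)
  ... | W-y j G∈Γ         | here refl               = ⊥-elim (y≢v j refl)
  ... | W-y j G∈Γ         | there k∈G               = inj₁ (lose G∈Γ (lose k∈G refl))
  ... | W-z j G∈Γ         | here refl               = ⊥-elim (z≢v j refl)
  ... | W-z j G∈Γ         | there k∈G               = inj₁ (lose G∈Γ (lose k∈G refl))

  profile : Clause → Fin m → Bool
  profile C j = does ((y j , false) ∈? C)

  module Fixing (b : Fin m → Bool) where

    α : Var → Bool
    α v with FinP.any? (λ j → y j ≟ v) | FinP.any? (λ j → z j ≟ v)
    ... | yes (j , _) | _           = b j
    ... | no _        | yes (j , _) = b j
    ... | no _        | no _        = false

    α-y : ∀ j → α (y j) ≡ b j
    α-y j with FinP.any? (λ i → y i ≟ y j)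
    ... | yes (i , yi≡yj) = cong b (y-injective yi≡yj)
    ... | no ∄i = ⊥-elim (∄i (j , refl))

    α-z : ∀ j → α (z j) ≡ b j
    α-z j with FinP.any? (λ i → y i ≟ z j) | FinP.any? (λ i → z i ≟ z j)
    ... | yes (i , yi≡zj) | _ = ⊥-elim (y≢z yi≡zj)
    ... | no _ | yes (i , zi≡zj) = cong b (z-injective zi≡zj)
    ... | no _ | no ∄i = ⊥-elim (∄i (j , refl))

    open Restriction Γ α public

    y-forced : ∀ j {s} → b j ≡ s → Forced (y j , s)
    y-forced j b≡s = y∉Γ j , trans (α-y j) b≡s

    z-forced : ∀ j {s} → b j ≡ s → Forced (z j , s)
    z-forced j b≡s = z∉Γ j , trans (α-z j) b≡s

    Iₘ-restricts : ∀ {D} → D ∈ Iₘ → Falsified D → restrict D ∈ Γ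
    Iₘ-restricts D∈Iₘ fD with ∈Iₘ⇒IClause D∈Iₘ
    ... | Γ-clause G∈Γ = subst (_∈ Γ) (sym (restrict-∈Γ G∈Γ)) G∈Γ
    ... | V-clause _ j _ with b j in b≡
    ...   | true  = ⊥-elim (fD (there (here (y-forced j b≡))))
    ...   | false = ⊥-elim (fD (there (there (here (z-forced j b≡)))))
    Iₘ-restricts D∈Iₘ fD | W-link j with b j in b≡
    ...   | true  = ⊥-elim (fD (there (here (z-forced j b≡))))
    ...   | false = ⊥-elim (fD (here (y-forced j b≡)))
    Iₘ-restricts D∈Iₘ fD | W-y j G∈Γ with b j in b≡
    ...   | true  = ⊥-elim (fD (here (y-forced j b≡)))
    ...   | false = subst (_∈ Γ) (sym (trans (restrict-fixed-∷ (y∉Γ j)) (restrict-∈Γ G∈Γ))) G∈Γ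
    Iₘ-restricts D∈Iₘ fD | W-z j G∈Γ with b j in b≡
    ...   | true  = subst (_∈ Γ) (sym (trans (restrict-fixed-∷ (z∉Γ j)) (restrict-∈Γ G∈Γ))) G∈Γ
    ...   | false = ⊥-elim (fD (here (z-forced j b≡)))

    Iₘ⇝Γ : Iₘ ⇝ Γ
    Iₘ⇝Γ = ⇝-Γ ∈-++⁺ˡ Iₘ-restricts

    profile-agrees : ∀ {C j} → Falsified C → (y j , false) ∈ C ⊎ (z j , true) ∈ C → b j ≡ profile C j
    profile-agrees {C} {j} fC ȳ∨z∈C with (y j , false) ∈? C
    ... | yes ȳ∈C = ¬-not λ b≡false → falsified-fixed fC ȳ∈C (y∉Γ j) (trans (α-y j) b≡false)
    ... | no ȳ∉C = ¬-not λ b≡true →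
      falsified-fixed fC (Sum.[ ⊥-elim ∘ ȳ∉C , id ] ȳ∨z∈C) (z∉Γ j) (trans (α-z j) b≡true)

    y-true-or-z-false : ∀ j → SatLit α (y j , true) ⊎ SatLit α (z j , false)
    y-true-or-z-false j with b j in b≡
    ... | true  = inj₁ (trans (α-y j) b≡)
    ... | false = inj₂ (trans (α-z j) b≡)

    link-isClause : ∀ j → IsClause ((y j , false) ∷ (z j , true) ∷ [])
    link-isClause j = ∷-isClause (λ { (here refl) → y≢z ; (there ()) }) (∷-isClause (λ ()) (λ ()))

    link-shape : ∀ j {u} → u ∈ ((y j , false) ∷ (z j , true) ∷ []) → u ≡ (y j , false) ⊎ u ≡ (z j , true)
    link-shape j (here refl) = inj₁ refl
    link-shape j (there (here refl)) = inj₂ refl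

    module _ {Δ C L} (Iₘ⊆Δ : Iₘ ⊆ Δ) (blocked : SetBlocked C L Δ) (fC : Falsified C) where
      open SetBlockedClause blocked

      covered-∉ : ∀ {a} → ¬ OccursIn (var a) Γ → (∀ {G} → G ∈ Γ → IClause (a ∷ G)) → neg a ∉ L
      covered-∉ a∉Γ a∨Γ ā∈L =
        Γ-unsat (satisfiable-if-covered ā∈L Γ λ G∈Γ → Iₘ⊆Δ (IClause⇒∈Iₘ (a∨Γ G∈Γ)) , fresh-∷-isClause a∉Γ G∈Γ)

      y-literal-∉ : ∀ j s → (y j , s) ∉ L
      y-literal-∉ j false = covered-∉ (y∉Γ j) (W-y j)
      y-literal-∉ j true =
        paired-∉ blocked fC (y∉Γ j) (z∉Γ j) (y-true-or-z-false j) (Iₘ⊆Δ (IClause⇒∈Iₘ (W-link j)))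
                 (link-isClause j) (here refl) (link-shape j) (covered-∉ (z∉Γ j) (W-z j))

      z-literal-∉ : ∀ j s → (z j , s) ∉ L
      z-literal-∉ j true = covered-∉ (z∉Γ j) (W-z j)
      z-literal-∉ j false =
        paired-∉ blocked fC (z∉Γ j) (y∉Γ j) (Sum.swap (y-true-or-z-false j)) (Iₘ⊆Δ (IClause⇒∈Iₘ (W-link j)))
                 (link-isClause j) (there (here refl)) (Sum.swap ∘ link-shape j) (covered-∉ (y∉Γ j) (W-y j))

      -- Blocking against x ∨ y_j ∨ z̄_j or x̄ ∨ y_j ∨ z̄_j puts ȳ_j or z_j into C,
      -- which pins the profile of C at j to b_j.
      extension-literal-∉ : Differs b (profile C) → ∀ {s} → s ∈ ext →
                            (∀ j → y j ≢ extVar s) → (∀ j → z j ≢ extVar s) → ∀ p → (extVar s , p) ∉ L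
      extension-literal-∉ (j , b≢profile) {s} s∈ y≢x z≢x p l∈L
        with complement-in-clause (Iₘ⊆Δ (IClause⇒∈Iₘ (V-clause s∈ j (not p)))) V-isClause
                                  (lose l∈L (here refl)) (All.tabulate miss)
        where
        V-isClause : IsClause ((extVar s , not p) ∷ (y j , true) ∷ (z j , false) ∷ [])
        V-isClause =
          ∷-isClause (λ { (here refl) → ≢-sym (y≢x j) ; (there (here refl)) → ≢-sym (z≢x j) ; (there (there ())) })
                     (∷-isClause (λ { (here refl) → y≢z ; (there ()) }) (∷-isClause (λ ()) (λ ())))
        miss : ∀ {k} → k ∈ L → k ∉ ((extVar s , not p) ∷ (y j , true) ∷ (z j , false) ∷ [])
        miss k∈L (here refl) = L-consistent l∈L k∈L
        miss k∈L (there (here refl)) = y-literal-∉ j true k∈L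
        miss k∈L (there (there (here refl))) = z-literal-∉ j false k∈L
      ... | _ , here refl , _ , l∉L = l∉L (subst (_∈ L) (cong (extVar s ,_) (sym (not-involutive p))) l∈L)
      ... | _ , there (here refl) , ȳ∈C , _ = b≢profile (profile-agrees fC (inj₁ ȳ∈C))
      ... | _ , there (there (here refl)) , z∈C , _ = b≢profile (profile-agrees fC (inj₂ z∈C))

      blocking-free : All (λ l → OccursIn (var l) Iₘ) C → Differs b (profile C) → All Free L
      blocking-free C-vars mismatch = All.tabulate literal-free
        where
        literal-free : ∀ {l} → l ∈ L → Free l
        literal-free {v , s} l∈L with FinP.any? (λ j → y j ≟ v) | FinP.any? (λ j → z j ≟ v)
        ... | yes (j , refl) | _ = ⊥-elim (y-literal-∉ j s l∈L)
        ... | no _ | yes (j , refl) = ⊥-elim (z-literal-∉ j s l∈L)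
        ... | no ∄y | no ∄z
          with occurs-Iₘ (All.lookup C-vars (L⊆C l∈L)) (λ j eq → ∄y (j , eq)) (λ j eq → ∄z (j , eq))
        ...   | inj₁ v∈Γ = v∈Γ
        ...   | inj₂ (_ , s∈ , refl) =
          ⊥-elim (extension-literal-∉ mismatch s∈ (λ j eq → ∄y (j , eq)) (λ j eq → ∄z (j , eq)) s l∈L)

    steps-blockingFree : ∀ {Cs} → All (All (λ l → OccursIn (var l) Iₘ)) Cs → All (Differs b ∘ profile) Cs →
                         All (BlockingFree Iₘ) Cs
    steps-blockingFree C-vars mismatches = All.zipWith clause-blockingFree (C-vars , mismatches)
      where
      clause-blockingFree : ∀ {C} → All (λ l → OccursIn (var l) Iₘ) C × Differs b (profile C) → BlockingFree Iₘ C
      clause-blockingFree (vars , mismatch) Iₘ⊆Δ blocked fC = blocking-free Iₘ⊆Δ blocked fC vars mismatch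

  short-refutation-restricts : (P : SBC⁻Proof Iₘ) → sizeSBC⁻ P < 2 ^ m →
                               Σ (SBC⁻Proof Γ) λ Q → sizeSBC⁻ Q ≤ sizeSBC⁻ P
  short-refutation-restricts P short =
    let (b , differs) = ∃-differing-from-all m (map profile steps) few-steps
        open Fixing b
    in restrict-refutation Iₘ⇝Γ proof (steps-blockingFree onlyVars (map⁻ differs))
    where
    open SBC⁻Proof P
    steps = Proof.steps proof
    few-steps : length (map profile steps) < 2 ^ m
    few-steps = subst (_< 2 ^ m) (sym (length-map profile steps)) (<-trans (n<1+n _) short)

lemma26 : (Γ : Formula) → IsFormula Γ → Unsatisfiable Γ →
          (e : ERProof Γ) → MinimumER Γ e →
          (m : ℕ) → 1 ≤ m →
          (y z : Fin m → Var) → FreshYZ Γ e m y z →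
          (P : SBC⁻Proof (I Γ e m y z)) →
          (2 ^ m ≤ sizeSBC⁻ P) ⊎ Σ (SBC⁻Proof Γ) (λ Q → sizeSBC⁻ Q ≤ sizeSBC⁻ P)
lemma26 Γ Γ-formula Γ-unsat e _ m _ y z fresh P with 2 ^ m ≤? sizeSBC⁻ P
... | yes long = inj₁ long
... | no short = inj₂ (short-refutation-restricts P (≰⇒> short))
  where open Construction Γ Γ-formula Γ-unsat e m y z fresh
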